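{- Let $x\in\mathbb{A}^\omega$ with $\mathbb{A}$ finite. The following are equivalent: (1) $x$ admits a prefixal factorization; (2) $x$ admits a unique factorization of the form $x=U_0U_1U_2\cdots$ with $U_i\in UP(x)$ for each $i\ge0$; (3) $\mathrm{card}(UP(x))<+\infty$.
   Context: A prefixal factorization of an infinite word $x$ is a factorization $x=V_0V_1V_2\cdots$ in which every $V_i$ is a non-empty prefix of $x$. A finite non-empty word $u$ is bordered if some non-empty word $v\neq u$ is both a prefix and a suffix of $u$, and unbordered otherwise. $UP(x)$ denotes the set of all non-empty unbordered prefixes of $x$. -}

module Defs where

open import Data.Nat using (ℕ; zero; suc; _+_; _∸_; _<_)
open import Data.Fin using (Fin)
open import Data.List using (List; []; map; upTo; _++_)
open import Data.List.Membership.Propositional using (_∈_)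
open import Data.Product using (Σ; ∃; ∃-syntax; _×_)
open import Relation.Nullary using (¬_)
open import Relation.Binary.PropositionalEquality using (_≡_; _≢_)

-- Alphabet: a finite set, represented as Fin k (any finite set is in bijection with some Fin k).
Alphabet : ℕ → Set
Alphabet k = Fin k

Word : Set → Set
Word A = List A

InfWord : Set → Set
InfWord A = ℕ → A

slice : {A : Set} → InfWord A → ℕ → ℕ → Word A
slice x s n = map (λ j → x (s + j)) (upTo n)

prefixOf : {A : Set} → InfWord A → ℕ → Word A
prefixOf x n = slice x 0 n

IsPrefixOf : {A : Set} → Word A → InfWord A → Set
IsPrefixOf u x = ∃[ n ] (u ≡ prefixOf x n)

IsPrefix : {A : Set} → Word A → Word A → Set
IsPrefix v u = ∃[ w ] (v ++ w ≡ u)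

IsSuffix : {A : Set} → Word A → Word A → Set
IsSuffix v u = ∃[ w ] (w ++ v ≡ u)

Bordered : {A : Set} → Word A → Set
Bordered u = ∃[ v ] (v ≢ [] × v ≢ u × IsPrefix v u × IsSuffix v u)

Unbordered : {A : Set} → Word A → Set
Unbordered u = u ≢ [] × ¬ Bordered u

InUP : {A : Set} → InfWord A → Word A → Set
InUP x u = IsPrefixOf u x × Unbordered u

-- A factorization x = W₀ W₁ W₂ ⋯ into non-empty finite words, given by its cut
-- positions 0 = cut 0 < cut 1 < cut 2 < ⋯ ; the i-th factor is x[cut i .. cut (i+1)).
record Factorization : Set where
  field
    cut      : ℕ → ℕ
    cut-zero : cut 0 ≡ 0
    cut-incr : ∀ i → cut i < cut (suc i)

open Factorization public

factor : {A : Set} → InfWord A → Factorization → ℕ → Word A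
factor x F i = slice x (cut F i) (cut F (suc i) ∸ cut F i)

IsPrefixal : {A : Set} → InfWord A → Factorization → Set
IsPrefixal x F = ∀ i → IsPrefixOf (factor x F i) x

HasPrefixalFactorization : {A : Set} → InfWord A → Set
HasPrefixalFactorization x = Σ Factorization (IsPrefixal x)

IsUPFactorization : {A : Set} → InfWord A → Factorization → Set
IsUPFactorization x F = ∀ i → InUP x (factor x F i)

SameFactorization : Factorization → Factorization → Set
SameFactorization F G = ∀ i → cut F i ≡ cut G i

HasUniqueUPFactorization : {A : Set} → InfWord A → Set
HasUniqueUPFactorization x =
  Σ Factorization λ F → IsUPFactorization x F ×
    (∀ G → IsUPFactorization x G → SameFactorization G F)

-- card(UP(x)) < ∞ : UP(x) is contained in some finite list of words.
UPFinite : {A : Set} → InfWord A → Set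
UPFinite {A} x = ∃[ L ] (∀ (u : Word A) → InUP x u → u ∈ L)

-- The factor x[s, e) is a prefix of x exactly when s is a period of the
-- prefix x[0, e), and it is moreover an unbordered prefix exactly when no r
-- with s < r < e is such a period.  Consequently an unbordered factor can
-- never strictly contain a cut of a factorization into prefixes: the piece
-- after the last cut inside it would be a border.  This one fact gives all
-- three implications.  A prefixal factorization bounds the unbordered
-- prefixes by |V₀|.  Two factorizations into unbordered prefixes agree cut by
-- cut.  And if every unbordered prefix has length at most B, the greedy
-- factorizations of the finite prefixes x[0, T) (whose last factor is the
-- shortest non-empty suffix that is a prefix of x) all pass through the same
-- cuts up to T - B, so together they define an infinite factorization.
module Submission where

open import Defs
open import Data.Nat using (ℕ)
open import Data.Product using (_×_)
open import Function.Bundles using (_⇔_)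

open import Data.Nat using (zero; suc; _+_; _∸_; _≤_; _<_; z≤n; s≤s; z<s; s<s; _≤?_; _<?_)
open import Data.Nat.Properties
open import Data.Nat.Induction using (<-rec)
import Data.Fin as Fin
open import Data.List using ([]; _∷_; _++_; length; map; applyUpTo)
open import Data.List.Properties
  using (length-applyUpTo; length-++; map-upTo; ∷-injectiveˡ; ∷-injectiveʳ)
open import Data.List.Extrema.Nat using (max; xs≤max)
open import Data.List.Membership.Propositional using (_∈_)
open import Data.List.Membership.Propositional.Properties using (∈-map⁺; ∈-applyUpTo⁺)
import Data.List.Relation.Unary.All as All
open import Data.Product using (∃-syntax; _,_; proj₁; proj₂)
open import Data.Empty using (⊥; ⊥-elim)
open import Data.Sum using (inj₁; inj₂)
open import Function.Base using (_∘_)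
open import Function.Bundles using (mk⇔; Equivalence)
open import Relation.Binary.Construct.Closure.ReflexiveTransitive using (Star; ε; _◅_; _◅◅_)
import Relation.Binary.Construct.Closure.ReflexiveTransitive as Star
open import Relation.Binary.Definitions using (DecidableEquality; tri<; tri≈; tri>)
open import Relation.Binary.PropositionalEquality
open import Relation.Nullary using (¬_; Dec; yes; no; map′; _→-dec_)
open import Relation.Unary using (Decidable)

open Equivalence using (to; from)

largest : ∀ {P : ℕ → Set} → Decidable P → P 0 →
          ∀ n → ∃[ r ] (r ≤ n × P r × (∀ {s} → r < s → s ≤ n → ¬ P s))
largest P? P0 zero = 0 , z≤n , P0 , λ { z<s () }
largest {P} P? P0 (suc n) with P? (suc n) | largest P? P0 n
... | yes Pn | _ = suc n , ≤-refl , Pn , λ n<s s≤n _ → <⇒≱ n<s s≤n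
... | no ¬Pn | r , r≤n , Pr , maximal = r , m≤n⇒m≤1+n r≤n , Pr , beyond
  where
  beyond : ∀ {s} → r < s → s ≤ suc n → ¬ P s
  beyond r<s s≤1+n with m≤n⇒m<n∨m≡n s≤1+n
  ... | inj₁ s<1+n = maximal r<s (≤-pred s<1+n)
  ... | inj₂ refl  = ¬Pn

module _ {A : Set} where

  HasPeriod : (ℕ → A) → ℕ → ℕ → Set
  HasPeriod f n d = ∀ {t} → d + t < n → f (d + t) ≡ f t

  HasPeriod-≤ : ∀ {f m n d} → HasPeriod f n d → m ≤ n → HasPeriod f m d
  HasPeriod-≤ period m≤n lt = period (<-≤-trans lt m≤n)

  applyUpTo-cong : ∀ (f g : ℕ → A) n → (∀ {t} → t < n → f t ≡ g t) →
                   applyUpTo f n ≡ applyUpTo g n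
  applyUpTo-cong f g zero    f≗g = refl
  applyUpTo-cong f g (suc n) f≗g =
    cong₂ _∷_ (f≗g z<s) (applyUpTo-cong (f ∘ suc) (g ∘ suc) n (f≗g ∘ s<s))

  applyUpTo-injective : ∀ (f g : ℕ → A) n → applyUpTo f n ≡ applyUpTo g n →
                        ∀ {t} → t < n → f t ≡ g t
  applyUpTo-injective f g (suc n) eq {zero}  _         = ∷-injectiveˡ eq
  applyUpTo-injective f g (suc n) eq {suc t} (s<s t<n) =
    applyUpTo-injective (f ∘ suc) (g ∘ suc) n (∷-injectiveʳ eq) t<n

  applyUpTo-++ : ∀ (f : ℕ → A) m n →
                 applyUpTo f (m + n) ≡ applyUpTo f m ++ applyUpTo (λ t → f (m + t)) n
  applyUpTo-++ f zero    n = refl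
  applyUpTo-++ f (suc m) n = cong (f 0 ∷_) (applyUpTo-++ (f ∘ suc) m n)

  prefix-applyUpTo : ∀ v {w} (f : ℕ → A) n → v ++ w ≡ applyUpTo f n →
                     v ≡ applyUpTo f (length v)
  prefix-applyUpTo []      f n       eq = refl
  prefix-applyUpTo (a ∷ v) f zero    ()
  prefix-applyUpTo (a ∷ v) f (suc n) eq =
    cong₂ _∷_ (∷-injectiveˡ eq) (prefix-applyUpTo v (f ∘ suc) n (∷-injectiveʳ eq))

  suffix-applyUpTo : ∀ w {v} (f : ℕ → A) n → w ++ v ≡ applyUpTo f n →
                     v ≡ applyUpTo (λ t → f (length w + t)) (length v)
  suffix-applyUpTo []      f n       refl = cong (applyUpTo f) (sym (length-applyUpTo f n))
  suffix-applyUpTo (a ∷ w) f zero    ()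
  suffix-applyUpTo (a ∷ w) f (suc n) eq   = suffix-applyUpTo w (f ∘ suc) n (∷-injectiveʳ eq)

  bordered⇒period : ∀ (f : ℕ → A) n → Bordered (applyUpTo f n) →
                    ∃[ d ] (0 < d × d < n × HasPeriod f n d)
  bordered⇒period f n ([] , v≢[] , _) = ⊥-elim (v≢[] refl)
  bordered⇒period f n (_ , _ , v≢u , _ , [] , v≡u) = ⊥-elim (v≢u v≡u)
  bordered⇒period f n (v@(_ ∷ _) , _ , _ , (w , v++w≡u) , (w'@(_ ∷ _) , w'++v≡u)) =
    length w' , z<s , subst (length w' <_) d+j≡n (m<m+n (length w') z<s) , period
    where
    d+j≡n : length w' + length v ≡ n
    d+j≡n = trans (sym (length-++ w')) (trans (cong length w'++v≡u) (length-applyUpTo f n))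
    period : HasPeriod f n (length w')
    period {t} lt =
      applyUpTo-injective (λ t → f (length w' + t)) f (length v)
        (trans (sym (suffix-applyUpTo w' f n w'++v≡u)) (prefix-applyUpTo v f n v++w≡u))
        (+-cancelˡ-< (length w') t (length v) (subst (length w' + t <_) (sym d+j≡n) lt))

  period⇒bordered : ∀ (f : ℕ → A) {n d} → 0 < d → d < n → HasPeriod f n d →
                    Bordered (applyUpTo f n)
  period⇒bordered f {d = d} 0<d d<n period with m≤n⇒∃[o]m+o≡n d<n
  ... | j , refl =
    v , (λ ()) , v≢u , (applyUpTo (λ t → f (suc j + t)) d , isPrefix) , (applyUpTo f d , isSuffix)
    where
    v = applyUpTo f (suc j)
    v≢u : v ≢ applyUpTo f (suc d + j)
    v≢u eq = <-irrefl (trans (sym (length-applyUpTo f (suc j)))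
                             (trans (cong length eq) (length-applyUpTo f _)))
                      (s<s (m<n+m j 0<d))
    isPrefix : v ++ applyUpTo (λ t → f (suc j + t)) d ≡ applyUpTo f (suc d + j)
    isPrefix = trans (sym (applyUpTo-++ f (suc j) d)) (cong (applyUpTo f ∘ suc) (+-comm j d))
    shifted : ∀ {t} → t < suc j → f t ≡ f (d + t)
    shifted {t} t<j = sym (period (subst (d + t <_) (+-suc d j) (+-monoʳ-< d t<j)))
    isSuffix : applyUpTo f d ++ v ≡ applyUpTo f (suc d + j)
    isSuffix = begin
      applyUpTo f d ++ v
        ≡⟨ cong (applyUpTo f d ++_) (applyUpTo-cong _ _ _ shifted) ⟩
      applyUpTo f d ++ applyUpTo (λ t → f (d + t)) (suc j)
        ≡⟨ applyUpTo-++ f d (suc j) ⟨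
      applyUpTo f (d + suc j)
        ≡⟨ cong (applyUpTo f) (+-suc d j) ⟩
      applyUpTo f (suc d + j)
        ∎
      where open ≡-Reasoning

n≤cut : ∀ F n → n ≤ cut F n
n≤cut F zero    = z≤n
n≤cut F (suc n) = ≤-<-trans (n≤cut F n) (cut-incr F n)

cuts-chain : ∀ {R : ℕ → ℕ → Set} F → (∀ k → R (cut F k) (cut F (suc k))) →
             ∀ j d → Star R (cut F j) (cut F (d + j))
cuts-chain F step j zero    = ε
cuts-chain F step j (suc d) = cuts-chain F step j d ◅◅ step (d + j) ◅ ε

firstStep : ∀ {R : ℕ → ℕ → Set} {p T} → Star R p T → p < T → ∃[ n ] (R p n × Star R n T)
firstStep ε        p<p = ⊥-elim (<-irrefl refl p<p)
firstStep (r ◅ rs) _   = _ , r , rs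

module _ {A : Set} (x : InfWord A) where

  -- x[s, e) is a prefix of x, i.e. s is a period of x[0, e)
  IsPrefixSegment : ℕ → ℕ → Set
  IsPrefixSegment s e = HasPeriod x e s

  PrefixStep : ℕ → ℕ → Set
  PrefixStep s e = s < e × IsPrefixSegment s e

  record IsUPSegment (s e : ℕ) : Set where
    field
      nonempty   : s < e
      isPrefix   : IsPrefixSegment s e
      unbordered : ∀ {r} → s < r → r < e → ¬ IsPrefixSegment r e

  open IsUPSegment

  period-shift : ∀ {s n d} → IsPrefixSegment s (s + n) →
                 HasPeriod (λ t → x (s + t)) n d ⇔ IsPrefixSegment (s + d) (s + n)
  period-shift {s} {n} {d} prefix = mk⇔ shifted unshifted
    where
    shifted : HasPeriod (λ t → x (s + t)) n d → IsPrefixSegment (s + d) (s + n)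
    shifted period {t} lt = begin
      x (s + d + t)   ≡⟨ cong x (+-assoc s d t) ⟩
      x (s + (d + t)) ≡⟨ period d+t<n ⟩
      x (s + t)       ≡⟨ prefix (+-monoʳ-< s (≤-<-trans (m≤n+m t d) d+t<n)) ⟩
      x t             ∎
      where
      open ≡-Reasoning
      d+t<n : d + t < n
      d+t<n = +-cancelˡ-< s (d + t) n (subst (_< s + n) (+-assoc s d t) lt)
    unshifted : IsPrefixSegment (s + d) (s + n) → HasPeriod (λ t → x (s + t)) n d
    unshifted period {t} lt = begin
      x (s + (d + t)) ≡⟨ cong x (+-assoc s d t) ⟨
      x (s + d + t)   ≡⟨ period (subst (_< s + n) (sym (+-assoc s d t)) (+-monoʳ-< s lt)) ⟩
      x t             ≡⟨ prefix (+-monoʳ-< s (≤-<-trans (m≤n+m t d) lt)) ⟨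
      x (s + t)       ∎
      where open ≡-Reasoning

  slice-applyUpTo : ∀ s n → slice x s n ≡ applyUpTo (λ t → x (s + t)) n
  slice-applyUpTo s n = map-upTo _ n

  length-slice : ∀ s n → length (slice x s n) ≡ n
  length-slice s n = trans (cong length (slice-applyUpTo s n)) (length-applyUpTo _ n)

  slice-isPrefixOf⇔ : ∀ s n → IsPrefixOf (slice x s n) x ⇔ IsPrefixSegment s (s + n)
  slice-isPrefixOf⇔ s n = mk⇔ toSegment fromSegment
    where
    toSegment : IsPrefixOf (slice x s n) x → IsPrefixSegment s (s + n)
    toSegment (m , eq) {t} lt = applyUpTo-injective _ x n samePrefix (+-cancelˡ-< s t n lt)
      where
      n≡m : n ≡ m
      n≡m = trans (sym (length-slice s n)) (trans (cong length eq) (length-slice 0 m))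
      samePrefix : applyUpTo (λ t → x (s + t)) n ≡ applyUpTo x n
      samePrefix = trans (sym (slice-applyUpTo s n))
                     (trans eq (trans (slice-applyUpTo 0 m) (cong (applyUpTo x) (sym n≡m))))
    fromSegment : IsPrefixSegment s (s + n) → IsPrefixOf (slice x s n) x
    fromSegment prefix = n , (begin
      slice x s n                         ≡⟨ slice-applyUpTo s n ⟩
      applyUpTo (λ t → x (s + t)) n       ≡⟨ applyUpTo-cong _ x n (prefix ∘ +-monoʳ-< s) ⟩
      applyUpTo x n                       ≡⟨ slice-applyUpTo 0 n ⟨
      prefixOf x n                        ∎)
      where open ≡-Reasoning

  slice-inUP⇔ : ∀ s n → InUP x (slice x s n) ⇔ IsUPSegment s (s + n)
  slice-inUP⇔ s n = mk⇔ toSegment fromSegment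
    where
    toSegment : InUP x (slice x s n) → IsUPSegment s (s + n)
    toSegment (isPrefixOf , slice≢[] , ¬bordered) = record
      { nonempty   = m<m+n s (0<length slice≢[])
      ; isPrefix   = prefix
      ; unbordered = λ s<r r<e period → ¬bordered (border s<r r<e period)
      }
      where
      prefix = to (slice-isPrefixOf⇔ s n) isPrefixOf
      0<length : ∀ {m} → slice x s m ≢ [] → 0 < m
      0<length {zero}  ne = ⊥-elim (ne refl)
      0<length {suc m} _  = z<s
      border : ∀ {r} → s < r → r < s + n → IsPrefixSegment r (s + n) → Bordered (slice x s n)
      border {r} s<r r<e period =
        subst Bordered (sym (slice-applyUpTo s n))
          (period⇒bordered _ (m<n⇒0<n∸m s<r) d<n (from (period-shift prefix) period'))
        where
        s+d≡r : s + (r ∸ s) ≡ r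
        s+d≡r = m+[n∸m]≡n (<⇒≤ s<r)
        d<n : r ∸ s < n
        d<n = +-cancelˡ-< s (r ∸ s) n (subst (_< s + n) (sym s+d≡r) r<e)
        period' : IsPrefixSegment (s + (r ∸ s)) (s + n)
        period' = subst (λ r → IsPrefixSegment r (s + n)) (sym s+d≡r) period
    fromSegment : IsUPSegment s (s + n) → InUP x (slice x s n)
    fromSegment segment =
      from (slice-isPrefixOf⇔ s n) (isPrefix segment) , slice≢[] (nonempty segment) , ¬bordered
      where
      slice≢[] : ∀ {m} → s < s + m → slice x s m ≢ []
      slice≢[] {zero}  s<s+0 = ⊥-elim (<-irrefl (sym (+-identityʳ s)) s<s+0)
      slice≢[] {suc m} _     = λ ()
      ¬bordered : ¬ Bordered (slice x s n)
      ¬bordered bordered with bordered⇒period _ n (subst Bordered (slice-applyUpTo s n) bordered)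
      ... | d , 0<d , d<n , period =
        unbordered segment (m<m+n s 0<d) (+-monoʳ-< s d<n)
          (to (period-shift (isPrefix segment)) period)

  segment-isPrefixOf⇔ : ∀ {s e} → s ≤ e → IsPrefixOf (slice x s (e ∸ s)) x ⇔ IsPrefixSegment s e
  segment-isPrefixOf⇔ {s} {e} s≤e =
    subst (λ e' → IsPrefixOf (slice x s (e ∸ s)) x ⇔ IsPrefixSegment s e')
          (m+[n∸m]≡n s≤e) (slice-isPrefixOf⇔ s (e ∸ s))

  segment-inUP⇔ : ∀ {s e} → s ≤ e → InUP x (slice x s (e ∸ s)) ⇔ IsUPSegment s e
  segment-inUP⇔ {s} {e} s≤e =
    subst (λ e' → InUP x (slice x s (e ∸ s)) ⇔ IsUPSegment s e')
          (m+[n∸m]≡n s≤e) (slice-inUP⇔ s (e ∸ s))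

  lastCutBelow : ∀ {q T e} → Star PrefixStep q T → q < e → e ≤ T →
                 ∃[ r ] (q ≤ r × r < e × IsPrefixSegment r e)
  lastCutBelow ε q<e e≤T = ⊥-elim (<⇒≱ q<e e≤T)
  lastCutBelow {q} {e = e} (_◅_ {j = q'} (q<q' , prefix) steps) q<e e≤T with e ≤? q'
  ... | yes e≤q' = q , ≤-refl , q<e , HasPeriod-≤ prefix e≤q'
  ... | no e≰q' with lastCutBelow steps (≰⇒> e≰q') e≤T
  ...   | r , q'≤r , r<e , prefix' = r , ≤-trans (<⇒≤ q<q') q'≤r , r<e , prefix'

  noCutInside : ∀ {p e q T} → IsUPSegment p e → Star PrefixStep q T →
                p < q → q < e → e ≤ T → ⊥
  noCutInside segment steps p<q q<e e≤T with lastCutBelow steps q<e e≤T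
  ... | r , q≤r , r<e , prefix = unbordered segment (<-≤-trans p<q q≤r) r<e prefix

  UPSegment⇒PrefixStep : ∀ {s e} → IsUPSegment s e → PrefixStep s e
  UPSegment⇒PrefixStep segment = nonempty segment , isPrefix segment

  firstUPSegment-unique : ∀ {p n n' T T'} → IsUPSegment p n → IsUPSegment p n' →
                          Star IsUPSegment n T → Star IsUPSegment n' T' →
                          n' ≤ T → n ≤ T' → n ≡ n'
  firstUPSegment-unique segment segment' chain chain' n'≤T n≤T' with <-cmp _ _
  ... | tri< n<n' _ _ = ⊥-elim
    (noCutInside segment' (Star.map UPSegment⇒PrefixStep chain) (nonempty segment) n<n' n'≤T)
  ... | tri≈ _ n≡n' _ = n≡n'
  ... | tri> _ _ n'<n = ⊥-elim
    (noCutInside segment (Star.map UPSegment⇒PrefixStep chain') (nonempty segment') n'<n n≤T')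

  factor-isUPSegment : ∀ F → IsUPFactorization x F →
                       ∀ k → IsUPSegment (cut F k) (cut F (suc k))
  factor-isUPSegment F up k = to (segment-inUP⇔ (<⇒≤ (cut-incr F k))) (up k)

  UPFactorization-unique : ∀ F G → IsUPFactorization x F → IsUPFactorization x G →
                           SameFactorization G F
  UPFactorization-unique F G upF upG zero    = trans (cut-zero G) (sym (cut-zero F))
  UPFactorization-unique F G upF upG (suc i) =
    firstUPSegment-unique
      (subst (λ p → IsUPSegment p (cut G (suc i))) same (factor-isUPSegment G upG i))
      (factor-isUPSegment F upF i)
      (cuts-chain {R = IsUPSegment} G (factor-isUPSegment G upG) (suc i) (cut F (suc i)))
      (cuts-chain {R = IsUPSegment} F (factor-isUPSegment F upF) (suc i) (cut G (suc i)))
      (≤-trans (m≤m+n _ (suc i)) (n≤cut G _))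
      (≤-trans (m≤m+n _ (suc i)) (n≤cut F _))
    where
    same : cut G i ≡ cut F i
    same = UPFactorization-unique F G upF upG i

  prefixal⇒UPSegment-bound : ∀ F {ℓ} → IsPrefixal x F → IsUPSegment 0 ℓ → ℓ ≤ cut F 1
  prefixal⇒UPSegment-bound F {ℓ} prefixal segment =
    ≮⇒≥ λ cut₁<ℓ → noCutInside segment (cuts-chain {R = PrefixStep} F step 1 ℓ) 0<cut₁ cut₁<ℓ
                     (≤-trans (m≤m+n ℓ 1) (n≤cut F _))
    where
    step : ∀ k → PrefixStep (cut F k) (cut F (suc k))
    step k = cut-incr F k , to (segment-isPrefixOf⇔ (<⇒≤ (cut-incr F k))) (prefixal k)
    0<cut₁ : 0 < cut F 1
    0<cut₁ = subst (_< cut F 1) (cut-zero F) (cut-incr F 0)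

  prefixal⇒UPFinite : HasPrefixalFactorization x → UPFinite x
  prefixal⇒UPFinite (F , prefixal) = applyUpTo (prefixOf x) (suc (cut F 1)) , listed
    where
    listed : ∀ u → InUP x u → u ∈ applyUpTo (prefixOf x) (suc (cut F 1))
    listed u inUP@((ℓ , refl) , _) = ∈-applyUpTo⁺ (prefixOf x)
      (s≤s (prefixal⇒UPSegment-bound F prefixal (to (slice-inUP⇔ 0 ℓ) inUP)))

  UPFinite⇒UPSegment-bound : UPFinite x → ∃[ B ] (∀ {s e} → IsUPSegment s e → e ≤ s + B)
  UPFinite⇒UPSegment-bound (L , complete) = max 0 (map length L) , bound
    where
    bound : ∀ {s e} → IsUPSegment s e → e ≤ s + max 0 (map length L)
    bound {s} {e} segment = subst (_≤ s + _) (m+[n∸m]≡n s≤e) (+-monoʳ-≤ s length≤max)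
      where
      s≤e = <⇒≤ (nonempty segment)
      length≤max : e ∸ s ≤ max 0 (map length L)
      length≤max = subst (_≤ _) (length-slice s (e ∸ s))
                     (All.lookup (xs≤max 0 (map length L))
                       (∈-map⁺ length (complete _ (from (segment-inUP⇔ s≤e) segment))))

  module _ (_≟_ : DecidableEquality A) where

    isPrefixSegment? : ∀ s e → Dec (IsPrefixSegment s e)
    isPrefixSegment? s e =
      map′ bounded unbounded (allUpTo? (λ t → (s + t <? e) →-dec (x (s + t) ≟ x t)) e)
      where
      bounded : (∀ {t} → t < e → s + t < e → x (s + t) ≡ x t) → IsPrefixSegment s e
      bounded h {t} lt = h (≤-<-trans (m≤n+m t s) lt) lt
      unbounded : IsPrefixSegment s e → ∀ {t} → t < e → s + t < e → x (s + t) ≡ x t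
      unbounded prefix _ = prefix

    lastUPSegment : ∀ T → ∃[ r ] IsUPSegment r (suc T)
    lastUPSegment T with largest (λ r → isPrefixSegment? r (suc T)) (λ _ → refl) T
    ... | r , r≤T , prefix , maximal = r , record
      { nonempty   = s≤s r≤T
      ; isPrefix   = prefix
      ; unbordered = λ r<r' r'<e → maximal r<r' (≤-pred r'<e)
      }

    greedyChain : ∀ T → Star IsUPSegment 0 T
    greedyChain = <-rec (Star IsUPSegment 0) extend
      where
      extend : ∀ T → (∀ {r} → r < T → Star IsUPSegment 0 r) → Star IsUPSegment 0 T
      extend zero    _          = ε
      extend (suc T) shorterChain with lastUPSegment T
      ... | r , segment = shorterChain (nonempty segment) ◅◅ segment ◅ ε

    module _ {B : ℕ} (bounded : ∀ {s e} → IsUPSegment s e → e ≤ s + B) where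

      -- All these chains start with the same factor (firstUPSegment-unique), so the
      -- first one determines the next cut.
      Settled : ℕ → Set
      Settled p = ∀ {T} → p + B < T → Star IsUPSegment p T

      settled-0 : Settled 0
      settled-0 _ = greedyChain _

      nextCut : ∀ {p} → Settled p → ∃[ n ] (IsUPSegment p n × Settled n)
      nextCut {p} settled with firstStep (settled ≤-refl) (s≤s (m≤m+n p B))
      ... | n , segment , chain = n , segment , settledN
        where
        p+B≤n+B = +-monoˡ-≤ B (<⇒≤ (nonempty segment))
        settledN : Settled n
        settledN {T} n+B<T with firstStep (settled p+B<T) (≤-<-trans (m≤m+n p B) p+B<T)
          where p+B<T = ≤-<-trans p+B≤n+B n+B<T
        ... | n' , segment' , chain' = subst (λ m → Star IsUPSegment m T) (sym n≡n') chain'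
          where
          n≡n' : n ≡ n'
          n≡n' = firstUPSegment-unique segment segment' chain chain'
                   (m≤n⇒m≤1+n (bounded segment'))
                   (≤-trans (bounded segment) (≤-trans p+B≤n+B (<⇒≤ n+B<T)))

      settledCuts : ℕ → ∃[ p ] Settled p
      settledCuts zero    = 0 , settled-0
      settledCuts (suc i) = let n , _ , settled = nextCut (proj₂ (settledCuts i)) in n , settled

      settledSegment : ∀ i → IsUPSegment (proj₁ (settledCuts i)) (proj₁ (settledCuts (suc i)))
      settledSegment i = proj₁ (proj₂ (nextCut (proj₂ (settledCuts i))))

      settledFactorization : Factorization
      settledFactorization = record
        { cut      = proj₁ ∘ settledCuts
        ; cut-zero = refl
        ; cut-incr = nonempty ∘ settledSegment
        }

    UPFinite⇒uniqueUP : UPFinite x → HasUniqueUPFactorization x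
    UPFinite⇒uniqueUP finite with UPFinite⇒UPSegment-bound finite
    ... | B , bounded = F , up , λ G upG → UPFactorization-unique F G up upG
      where
      F = settledFactorization bounded
      up : IsUPFactorization x F
      up i = from (segment-inUP⇔ (<⇒≤ (nonempty segment))) segment
        where segment = settledSegment bounded i

  uniqueUP⇒prefixal : HasUniqueUPFactorization x → HasPrefixalFactorization x
  uniqueUP⇒prefixal (F , up , _) = F , proj₁ ∘ up

mainTheorem3 : (k : ℕ) (x : InfWord (Alphabet k)) →
    (HasPrefixalFactorization x ⇔ HasUniqueUPFactorization x) ×
    (HasUniqueUPFactorization x ⇔ UPFinite x)
mainTheorem3 k x =
  mk⇔ (UPFinite⇒uniqueUP x Fin._≟_ ∘ prefixal⇒UPFinite x) (uniqueUP⇒prefixal x) ,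
  mk⇔ (prefixal⇒UPFinite x ∘ uniqueUP⇒prefixal x) (UPFinite⇒uniqueUP x Fin._≟_)
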